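{- Let $\Gamma$ be a set of $\mathsf{Inc}$-formulas and $\alpha(\mathsf{x})$ a first-order formula with free variables among $\mathsf{x}$. Let $\dot{\sim}\alpha$ denote the $\mathsf{Inc}$-formula $\exists\mathsf{y}(\mathsf{y}\subseteq\mathsf{x}\wedge\neg\alpha(\mathsf{y}/\mathsf{x}))$, where $\mathsf{y}$ is a sequence of fresh variables (not occurring in $\Gamma$ or $\alpha$) with $|\mathsf{y}|=|\mathsf{x}|$. If $\Gamma,\dot{\sim}\alpha\vdash_{\mathsf{Inc}}\bot$, then $\Gamma\vdash_{\mathsf{Inc}}\alpha$.
   Context: Syntax. $\mathscr{L}$ is a first-order signature with equality. First-order formulas are $\alpha::=\bot\mid t_1=t_2\mid Rt_1\dots t_n\mid\neg\alpha\mid\alpha\wedge\alpha\mid\alpha\vee\alpha\mid\exists x\alpha\mid\forall x\alpha$; $\alpha\to\beta$ abbreviates $\neg\alpha\vee\beta$ and $\alpha\leftrightarrow\beta$ abbreviates $(\alpha\to\beta)\wedge(\beta\to\alpha)$. Formulas of inclusion logic ($\mathsf{Inc}$) are $\phi::=\bot\mid\alpha\mid\neg\alpha\mid x_1\dots x_n\subseteq y_1\dots y_n\mid\phi\wedge\phi\mid\phi\vee\phi\mid\exists x\phi\mid\forall x\phi$ with $\alpha$ first-order. Free variables as usual, with $\mathsf{Fv}(x_1\dots x_n\subseteq y_1\dots y_n)=\{x_1,\dots,y_n\}$. Sans-serif letters denote finite (possibly empty) sequences of variables, $|\mathsf{x}|$ the length, $\exists\mathsf{x}$ / $\forall\mathsf{x}$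 strings of quantifiers, $\mathsf{x}=\mathsf{y}$ abbreviates $\bigwedge_i x_i=y_i$, $\phi(t/x)$ substitution. Deduction system. $\Gamma\vdash_{\mathsf{Inc}}\phi$ means $\phi$ is derivable from $\Gamma$ with the following rules ($\phi,\psi,\chi$ arbitrary $\mathsf{Inc}$-formulas, $\alpha$ first-order; "fresh" = not occurring in the formulas involved; "invertible" rules apply in both directions): (=I) derive $t=t$. (=Sub) from $t=t'$ and $\phi(t/x)$ derive $\phi(t'/x)$. ($\neg$I) from a derivation of $\bot$ from assumption $\alpha$ derive $\neg\alpha$; ($\neg$E) from $\alpha$ and $\neg\alpha$ derive any $\phi$; (RAA) from a derivation of $\bot$ from assumption $\neg\alpha$ derive $\alpha$; in $\neg$I and RAA all other undischarged assumptions of the subderivation must be first-order. ($\wedge$I), ($\wedge$E), ($\vee$I) as usual. ($\vee$E) from $\phi\vee\psi$, a derivation of $\chi$ from $\phi$ and a derivation of $\chi$ from $\psi$, derive $\chi$, provided all other undischarged assumptions of the two subderivations are first-order. ($\exists$I) from $\phi(t/x)$ derive $\exists x\phi$. ($\exists$E) from $\exists x\phi$ and a derivation of $\psi$ from $\phi$ derive $\psi$, provided $x$ is not free in $\psi$ nor in other undischarged assumptions of that subderivation. ($\forall$I) from $\phi$ derive $\forall x\phi$ if $x$ is not free in any undischarged assumption. ($\forall$E) from $\forall x\alpha$ derive $\alpha(t/x)$. ($\forall$E$_0$) from $\forall x\phi$ derive $\phi$ if $x$ is not free in $\phi$. ($\forall$Sub) from $\forall x\phi$ and a derivation of $\psi$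 from $\phi(y/x)$ derive $\forall y\psi$, provided $y$ is not free in $\forall x\phi$ nor in other undischarged assumptions of the subderivation. ($\forall$Exc) from $\forall x\forall y\phi$ derive $\forall y\forall x\phi$. ($\forall_\wedge$Ext) from $\forall x\phi$ and $\forall x\psi$ derive $\forall x(\phi\wedge\psi)$. ($\forall_\vee$Ext, invertible) $\forall x\phi(x,\mathsf{v})\vee\psi(\mathsf{v})$ / $\exists y\exists z\forall x((\phi\wedge y=z)\vee(\psi\wedge y\neq z))$, $x$ not free in $\psi$, $y,z$ fresh. ($\subseteq$Exc) from $\mathsf{x}\mathsf{y}\mathsf{z}\subseteq\mathsf{u}\mathsf{v}\mathsf{w}$ derive $\mathsf{y}\mathsf{x}\mathsf{z}\subseteq\mathsf{v}\mathsf{u}\mathsf{w}$. ($\subseteq$Ctr) from $\mathsf{x}\mathsf{y}\subseteq\mathsf{u}\mathsf{v}$ derive $\mathsf{x}\subseteq\mathsf{u}$ ($|\mathsf{x}|=|\mathsf{u}|$). ($\subseteq$Trs) from $\mathsf{x}\subseteq\mathsf{y}$ and $\mathsf{y}\subseteq\mathsf{z}$ derive $\mathsf{x}\subseteq\mathsf{z}$. ($\subseteq$Cmp) from $\mathsf{y}\subseteq\mathsf{x}$ and $\alpha(\mathsf{x}/\mathsf{z})$ derive $\alpha(\mathsf{y}/\mathsf{z})$, the free variables of $\alpha(\mathsf{x}/\mathsf{z})$ being among $\mathsf{x}$. ($\subseteq$Exp) from a derivation of $\bot$ from assumptions $\mathsf{y}\subseteq\mathsf{x}$ and $\neg\alpha(\mathsf{y}/\mathsf{z})$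 derive $\alpha(\mathsf{x}/\mathsf{z})$, where the free variables of $\alpha(\mathsf{y}/\mathsf{z})$ are among $\mathsf{y}$ and the variables of $\mathsf{y}$ are not free in any other undischarged assumption. ($\subseteq$W$_\exists$) from $\mathsf{x}\subseteq\mathsf{y}$ derive $\exists w(\mathsf{x}w\subseteq\mathsf{y}z)$, $w$ not among $\mathsf{x}\mathsf{y}z$. ($\subseteq$W$_\forall$) from $\mathsf{x}\subseteq\mathsf{y}$ derive $\forall w(\mathsf{x}z\subseteq\mathsf{y}w)$, $w$ not among $\mathsf{x}\mathsf{y}z$. ($\forall\subseteq$Sim, invertible) $\forall\mathsf{x}\phi(\mathsf{x},\mathsf{z})$ / $\exists\mathsf{x}\forall\mathsf{y}(\mathsf{z}\mathsf{y}\subseteq\mathsf{z}\mathsf{x}\wedge\phi(\mathsf{x},\mathsf{z}))$, $\mathsf{y}$ fresh, $|\mathsf{y}|=|\mathsf{x}|$. ($\exists\subseteq$Ext) from $\exists\mathsf{x}(\bigwedge_{i\in I}\rho^i\subseteq\sigma^i\wedge\alpha)\vee\phi$ derive $\exists\mathsf{x}\exists u\exists v(\bigwedge_{i\in I}\rho^iuv\subseteq\sigma^iuv\wedge(\alpha\leftrightarrow u=v)\wedge(\alpha\vee\phi))$, $I$ finite, $\rho^i,\sigma^i$ equal-length sequences of variables from $\mathsf{x}$, $u,v$ fresh. -}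

module Defs where

open import Data.Nat using (ℕ; _≡ᵇ_; _+_)
open import Data.Bool using (if_then_else_)
open import Data.Unit using (⊤)
open import Data.Empty renaming (⊥ to Empty)
open import Data.Product using (_×_; Σ; ∃; _,_)
open import Data.Sum using (_⊎_)
open import Data.List using (List; []; _∷_) renaming (_++_ to _++ₗ_)
open import Data.List.Relation.Unary.All using (All)
open import Data.List.Relation.Binary.Subset.Propositional renaming (_⊆_ to _⊆ₗ_)
open import Data.List.Membership.Propositional renaming (_∈_ to _∈ₗ_)
open import Data.List.Relation.Unary.Unique.Propositional using (Unique)
open import Data.Vec using (Vec; []; _∷_; toList) renaming (_++_ to _++ᵥ_; map to mapᵥ)
open import Data.Vec.Membership.Propositional renaming (_∈_ to _∈ᵥ_)
open import Relation.Binary.PropositionalEquality using (_≡_)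
open import Relation.Nullary using (¬_)

record Signature : Set₁ where
  field
    Fun   : Set
    funAr : Fun → ℕ
    Rel   : Set
    relAr : Rel → ℕ

Var : Set
Var = ℕ

Distinct : ∀ {n} → Vec Var n → Set
Distinct xs = Unique (toList xs)

module Syntax (ℒ : Signature) where
  open Signature ℒ

  data Term : Set where
    var : Var → Term
    app : (f : Fun) → Vec Term (funAr f) → Term

  mutual
    varsT : Term → List Var
    varsT (var x) = x ∷ []
    varsT (app f ts) = varsTs ts

    varsTs : ∀ {n} → Vec Term n → List Var
    varsTs [] = []
    varsTs (t ∷ ts) = varsT t ++ₗ varsTs ts

  -- One formula type; FO and IsInc below carve out the first-order and
  -- the inclusion-logic formulas.
  infixr 6 _∧ᶠ_
  infixr 5 _∨ᶠ_
  infix 7 _≐_ _⊆ᶠ_ _≠ᶠ_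
  infixr 4 _→ᶠ_ _↔ᶠ_
  data Fm : Set where
    ⊥ᶠ   : Fm
    _≐_  : Term → Term → Fm
    rel  : (R : Rel) → Vec Term (relAr R) → Fm
    ¬ᶠ   : Fm → Fm
    _∧ᶠ_ : Fm → Fm → Fm
    _∨ᶠ_ : Fm → Fm → Fm
    ∃ᶠ   : Var → Fm → Fm
    ∀ᶠ   : Var → Fm → Fm
    _⊆ᶠ_ : ∀ {k} → Vec Var k → Vec Var k → Fm

  _→ᶠ_ : Fm → Fm → Fm
  α →ᶠ β = ¬ᶠ α ∨ᶠ β

  _↔ᶠ_ : Fm → Fm → Fm
  α ↔ᶠ β = (α →ᶠ β) ∧ᶠ (β →ᶠ α)

  _≠ᶠ_ : Term → Term → Fm
  t ≠ᶠ u = ¬ᶠ (t ≐ u)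

  ∃* : ∀ {n} → Vec Var n → Fm → Fm
  ∃* [] φ = φ
  ∃* (x ∷ xs) φ = ∃ᶠ x (∃* xs φ)

  ∀* : ∀ {n} → Vec Var n → Fm → Fm
  ∀* [] φ = φ
  ∀* (x ∷ xs) φ = ∀ᶠ x (∀* xs φ)

  bigAnd : List Fm → Fm → Fm
  bigAnd [] β = β
  bigAnd (χ ∷ χs) β = χ ∧ᶠ bigAnd χs β

  FO : Fm → Set
  FO ⊥ᶠ = ⊤
  FO (t ≐ u) = ⊤
  FO (rel R ts) = ⊤
  FO (¬ᶠ φ) = FO φ
  FO (φ ∧ᶠ ψ) = FO φ × FO ψ
  FO (φ ∨ᶠ ψ) = FO φ × FO ψ
  FO (∃ᶠ x φ) = FO φ
  FO (∀ᶠ x φ) = FO φ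
  FO (xs ⊆ᶠ ys) = Empty

  IsInc : Fm → Set
  IsInc ⊥ᶠ = ⊤
  IsInc (t ≐ u) = ⊤
  IsInc (rel R ts) = ⊤
  IsInc (¬ᶠ φ) = FO φ
  IsInc (φ ∧ᶠ ψ) = IsInc φ × IsInc ψ
  IsInc (φ ∨ᶠ ψ) = IsInc φ × IsInc ψ
  IsInc (∃ᶠ x φ) = IsInc φ
  IsInc (∀ᶠ x φ) = IsInc φ
  IsInc (xs ⊆ᶠ ys) = ⊤

  FreeIn : Var → Fm → Set
  FreeIn x ⊥ᶠ = Empty
  FreeIn x (t ≐ u) = x ∈ₗ varsT t ⊎ x ∈ₗ varsT u
  FreeIn x (rel R ts) = x ∈ₗ varsTs ts
  FreeIn x (¬ᶠ φ) = FreeIn x φ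
  FreeIn x (φ ∧ᶠ ψ) = FreeIn x φ ⊎ FreeIn x ψ
  FreeIn x (φ ∨ᶠ ψ) = FreeIn x φ ⊎ FreeIn x ψ
  FreeIn x (∃ᶠ y φ) = ¬ (x ≡ y) × FreeIn x φ
  FreeIn x (∀ᶠ y φ) = ¬ (x ≡ y) × FreeIn x φ
  FreeIn x (xs ⊆ᶠ ys) = x ∈ᵥ xs ⊎ x ∈ᵥ ys

  Occurs : Var → Fm → Set
  Occurs x ⊥ᶠ = Empty
  Occurs x (t ≐ u) = x ∈ₗ varsT t ⊎ x ∈ₗ varsT u
  Occurs x (rel R ts) = x ∈ₗ varsTs ts
  Occurs x (¬ᶠ φ) = Occurs x φ
  Occurs x (φ ∧ᶠ ψ) = Occurs x φ ⊎ Occurs x ψ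
  Occurs x (φ ∨ᶠ ψ) = Occurs x φ ⊎ Occurs x ψ
  Occurs x (∃ᶠ y φ) = x ≡ y ⊎ Occurs x φ
  Occurs x (∀ᶠ y φ) = x ≡ y ⊎ Occurs x φ
  Occurs x (xs ⊆ᶠ ys) = x ∈ᵥ xs ⊎ x ∈ᵥ ys

  Subst : Set
  Subst = Var → Term

  -- σ updated so that y is left untouched (used under a binder of y)
  keep : Subst → Var → Subst
  keep σ y z = if z ≡ᵇ y then var y else σ z

  [_↦_] : Var → Term → Subst
  [ x ↦ t ] z = if z ≡ᵇ x then t else var z

  [_↦*_] : ∀ {n} → Vec Var n → Vec Term n → Subst
  [ [] ↦* [] ] z = var z
  [ (x ∷ xs) ↦* (t ∷ ts) ] z = if z ≡ᵇ x then t else [ xs ↦* ts ] z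

  mutual
    subT : Subst → Term → Term
    subT σ (var x) = σ x
    subT σ (app f ts) = app f (subTs σ ts)

    subTs : Subst → ∀ {n} → Vec Term n → Vec Term n
    subTs σ [] = []
    subTs σ (t ∷ ts) = subT σ t ∷ subTs σ ts

  -- Sub σ φ φ' : φ' is the result φσ of the substitution, which is only
  -- defined when no variable gets captured and inclusion atoms receive
  -- variables only (inclusion atoms contain variables only).
  data Sub (σ : Subst) : Fm → Fm → Set where
    s⊥   : Sub σ ⊥ᶠ ⊥ᶠ
    s≐   : ∀ {t u} → Sub σ (t ≐ u) (subT σ t ≐ subT σ u)
    srel : ∀ {R ts} → Sub σ (rel R ts) (rel R (subTs σ ts))
    s¬   : ∀ {φ φ'} → Sub σ φ φ' → Sub σ (¬ᶠ φ) (¬ᶠ φ')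
    s∧   : ∀ {φ φ' ψ ψ'} → Sub σ φ φ' → Sub σ ψ ψ' → Sub σ (φ ∧ᶠ ψ) (φ' ∧ᶠ ψ')
    s∨   : ∀ {φ φ' ψ ψ'} → Sub σ φ φ' → Sub σ ψ ψ' → Sub σ (φ ∨ᶠ ψ) (φ' ∨ᶠ ψ')
    s∃   : ∀ {y φ φ'} → (∀ x → FreeIn x (∃ᶠ y φ) → ¬ (y ∈ₗ varsT (σ x))) →
           Sub (keep σ y) φ φ' → Sub σ (∃ᶠ y φ) (∃ᶠ y φ')
    s∀   : ∀ {y φ φ'} → (∀ x → FreeIn x (∀ᶠ y φ) → ¬ (y ∈ₗ varsT (σ x))) →
           Sub (keep σ y) φ φ' → Sub σ (∀ᶠ y φ) (∀ᶠ y φ')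
    s⊆   : ∀ {k} {xs ys xs' ys' : Vec Var k} →
           mapᵥ σ xs ≡ mapᵥ var xs' → mapᵥ σ ys ≡ mapᵥ var ys' →
           Sub σ (xs ⊆ᶠ ys) (xs' ⊆ᶠ ys')

  incs : List (Σ ℕ (λ k → Vec Var k × Vec Var k)) → List Fm
  incs [] = []
  incs ((k , ρ , σ) ∷ I) = (ρ ⊆ᶠ σ) ∷ incs I

  incsUV : Var → Var → List (Σ ℕ (λ k → Vec Var k × Vec Var k)) → List Fm
  incsUV u v [] = []
  incsUV u v ((k , ρ , σ) ∷ I) =
    ((ρ ++ᵥ (u ∷ v ∷ [])) ⊆ᶠ (σ ++ᵥ (u ∷ v ∷ []))) ∷ incsUV u v I

  -- The natural deduction system, in sequent form: Δ ⊢ φ means there is a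
  -- derivation of φ whose undischarged assumptions are among the list Δ.
  -- Side conditions on "other undischarged assumptions" are imposed on the
  -- assumption list of the relevant subderivation.

  infix 3 _⊢_
  data _⊢_ : List Fm → Fm → Set where
    hyp    : ∀ {Δ φ} → φ ∈ₗ Δ → Δ ⊢ φ
    weak   : ∀ {Δ Δ' φ} → Δ ⊆ₗ Δ' → Δ ⊢ φ → Δ' ⊢ φ
    =I     : ∀ {Δ t} → Δ ⊢ t ≐ t
    =Sub   : ∀ {Δ φ x t t' φ₁ φ₂} → Sub [ x ↦ t ] φ φ₁ → Sub [ x ↦ t' ] φ φ₂ →
             Δ ⊢ t ≐ t' → Δ ⊢ φ₁ → Δ ⊢ φ₂
    ¬I     : ∀ {Δ α} → FO α → All FO Δ → (α ∷ Δ) ⊢ ⊥ᶠ → Δ ⊢ ¬ᶠ α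
    ¬E     : ∀ {Δ α φ} → FO α → IsInc φ → Δ ⊢ α → Δ ⊢ ¬ᶠ α → Δ ⊢ φ
    RAA    : ∀ {Δ α} → FO α → All FO Δ → (¬ᶠ α ∷ Δ) ⊢ ⊥ᶠ → Δ ⊢ α
    ∧I     : ∀ {Δ φ ψ} → Δ ⊢ φ → Δ ⊢ ψ → Δ ⊢ φ ∧ᶠ ψ
    ∧E₁    : ∀ {Δ φ ψ} → Δ ⊢ φ ∧ᶠ ψ → Δ ⊢ φ
    ∧E₂    : ∀ {Δ φ ψ} → Δ ⊢ φ ∧ᶠ ψ → Δ ⊢ ψ
    ∨I₁    : ∀ {Δ φ ψ} → IsInc ψ → Δ ⊢ φ → Δ ⊢ φ ∨ᶠ ψ
    ∨I₂    : ∀ {Δ φ ψ} → IsInc φ → Δ ⊢ ψ → Δ ⊢ φ ∨ᶠ ψ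
    ∨E     : ∀ {Δ Δ' φ ψ χ} → All FO Δ' →
             Δ ⊢ φ ∨ᶠ ψ → (φ ∷ Δ') ⊢ χ → (ψ ∷ Δ') ⊢ χ → (Δ ++ₗ Δ') ⊢ χ
    ∃I     : ∀ {Δ x t φ φ'} → Sub [ x ↦ t ] φ φ' → Δ ⊢ φ' → Δ ⊢ ∃ᶠ x φ
    ∃E     : ∀ {Δ Δ' x φ ψ} → ¬ FreeIn x ψ → All (λ χ → ¬ FreeIn x χ) Δ' →
             Δ ⊢ ∃ᶠ x φ → (φ ∷ Δ') ⊢ ψ → (Δ ++ₗ Δ') ⊢ ψ
    ∀I     : ∀ {Δ x φ} → All (λ χ → ¬ FreeIn x χ) Δ → Δ ⊢ φ → Δ ⊢ ∀ᶠ x φ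
    ∀E     : ∀ {Δ x t α α'} → FO α → Sub [ x ↦ t ] α α' → Δ ⊢ ∀ᶠ x α → Δ ⊢ α'
    ∀E₀    : ∀ {Δ x φ} → ¬ FreeIn x φ → Δ ⊢ ∀ᶠ x φ → Δ ⊢ φ
    ∀Sub   : ∀ {Δ Δ' x y φ φ' ψ} → Sub [ x ↦ var y ] φ φ' →
             ¬ FreeIn y (∀ᶠ x φ) → All (λ χ → ¬ FreeIn y χ) Δ' →
             Δ ⊢ ∀ᶠ x φ → (φ' ∷ Δ') ⊢ ψ → (Δ ++ₗ Δ') ⊢ ∀ᶠ y ψ
    ∀Exc   : ∀ {Δ x y φ} → Δ ⊢ ∀ᶠ x (∀ᶠ y φ) → Δ ⊢ ∀ᶠ y (∀ᶠ x φ)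
    ∀∧Ext  : ∀ {Δ x φ ψ} → Δ ⊢ ∀ᶠ x φ → Δ ⊢ ∀ᶠ x ψ → Δ ⊢ ∀ᶠ x (φ ∧ᶠ ψ)
    ∀∨Ext  : ∀ {Δ x y z φ ψ} → ¬ FreeIn x ψ → ¬ (y ≡ z) →
             ¬ Occurs y (∀ᶠ x φ ∨ᶠ ψ) → ¬ Occurs z (∀ᶠ x φ ∨ᶠ ψ) →
             Δ ⊢ ∀ᶠ x φ ∨ᶠ ψ →
             Δ ⊢ ∃ᶠ y (∃ᶠ z (∀ᶠ x ((φ ∧ᶠ var y ≐ var z) ∨ᶠ (ψ ∧ᶠ var y ≠ᶠ var z))))
    ∀∨Ext⁻ : ∀ {Δ x y z φ ψ} → ¬ FreeIn x ψ → ¬ (y ≡ z) →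
             ¬ Occurs y (∀ᶠ x φ ∨ᶠ ψ) → ¬ Occurs z (∀ᶠ x φ ∨ᶠ ψ) →
             Δ ⊢ ∃ᶠ y (∃ᶠ z (∀ᶠ x ((φ ∧ᶠ var y ≐ var z) ∨ᶠ (ψ ∧ᶠ var y ≠ᶠ var z)))) →
             Δ ⊢ ∀ᶠ x φ ∨ᶠ ψ
    ⊆Exc   : ∀ {Δ a b c} {x u : Vec Var a} {y v : Vec Var b} {z w : Vec Var c} →
             Δ ⊢ (x ++ᵥ y ++ᵥ z) ⊆ᶠ (u ++ᵥ v ++ᵥ w) →
             Δ ⊢ (y ++ᵥ x ++ᵥ z) ⊆ᶠ (v ++ᵥ u ++ᵥ w)
    ⊆Ctr   : ∀ {Δ a b} {x u : Vec Var a} {y v : Vec Var b} →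
             Δ ⊢ (x ++ᵥ y) ⊆ᶠ (u ++ᵥ v) → Δ ⊢ x ⊆ᶠ u
    ⊆Trs   : ∀ {Δ a} {x y z : Vec Var a} → Δ ⊢ x ⊆ᶠ y → Δ ⊢ y ⊆ᶠ z → Δ ⊢ x ⊆ᶠ z
    ⊆Cmp   : ∀ {Δ a α α₁ α₂} {x y z : Vec Var a} → FO α → Distinct z →
             Sub [ z ↦* mapᵥ var x ] α α₁ → Sub [ z ↦* mapᵥ var y ] α α₂ →
             (∀ v → FreeIn v α₁ → v ∈ᵥ x) →
             Δ ⊢ y ⊆ᶠ x → Δ ⊢ α₁ → Δ ⊢ α₂
    ⊆Exp   : ∀ {Δ a α αy αx} {x y z : Vec Var a} → FO α → Distinct z → Distinct y →
             Sub [ z ↦* mapᵥ var y ] α αy → Sub [ z ↦* mapᵥ var x ] α αx →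
             (∀ v → FreeIn v αy → v ∈ᵥ y) →
             All (λ χ → ∀ v → v ∈ᵥ y → ¬ FreeIn v χ) Δ →
             (y ⊆ᶠ x ∷ ¬ᶠ αy ∷ Δ) ⊢ ⊥ᶠ → Δ ⊢ αx
    ⊆W∃    : ∀ {Δ a z w} {x y : Vec Var a} → ¬ (w ∈ᵥ x) → ¬ (w ∈ᵥ y) → ¬ (w ≡ z) →
             Δ ⊢ x ⊆ᶠ y → Δ ⊢ ∃ᶠ w ((x ++ᵥ (w ∷ [])) ⊆ᶠ (y ++ᵥ (z ∷ [])))
    ⊆W∀    : ∀ {Δ a z w} {x y : Vec Var a} → ¬ (w ∈ᵥ x) → ¬ (w ∈ᵥ y) → ¬ (w ≡ z) →
             Δ ⊢ x ⊆ᶠ y → Δ ⊢ ∀ᶠ w ((x ++ᵥ (z ∷ [])) ⊆ᶠ (y ++ᵥ (w ∷ [])))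
    ∀⊆Sim  : ∀ {Δ a b φ} {x y : Vec Var a} {z : Vec Var b} →
             Distinct x → Distinct y →
             (∀ v → FreeIn v φ → v ∈ᵥ x ⊎ v ∈ᵥ z) →
             (∀ v → v ∈ᵥ z → ¬ (v ∈ᵥ x)) →
             (∀ v → v ∈ᵥ y → ¬ Occurs v (∀* x φ) × ¬ (v ∈ᵥ z)) →
             Δ ⊢ ∀* x φ → Δ ⊢ ∃* x (∀* y (((z ++ᵥ y) ⊆ᶠ (z ++ᵥ x)) ∧ᶠ φ))
    ∀⊆Sim⁻ : ∀ {Δ a b φ} {x y : Vec Var a} {z : Vec Var b} →
             Distinct x → Distinct y →
             (∀ v → FreeIn v φ → v ∈ᵥ x ⊎ v ∈ᵥ z) →
             (∀ v → v ∈ᵥ z → ¬ (v ∈ᵥ x)) →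
             (∀ v → v ∈ᵥ y → ¬ Occurs v (∀* x φ) × ¬ (v ∈ᵥ z)) →
             Δ ⊢ ∃* x (∀* y (((z ++ᵥ y) ⊆ᶠ (z ++ᵥ x)) ∧ᶠ φ)) → Δ ⊢ ∀* x φ
    ∃⊆Ext  : ∀ {Δ a u v α φ} {x : Vec Var a}
             (I : List (Σ ℕ (λ k → Vec Var k × Vec Var k))) →
             FO α → ¬ (u ≡ v) →
             All (λ { (k , ρ , σ) → ∀ w → (w ∈ᵥ ρ ⊎ w ∈ᵥ σ) → w ∈ᵥ x }) I →
             ¬ Occurs u (∃* x (bigAnd (incs I) α) ∨ᶠ φ) →
             ¬ Occurs v (∃* x (bigAnd (incs I) α) ∨ᶠ φ) →
             Δ ⊢ ∃* x (bigAnd (incs I) α) ∨ᶠ φ →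
             Δ ⊢ ∃* x (∃ᶠ u (∃ᶠ v (bigAnd (incsUV u v I)
                     ((α ↔ᶠ var u ≐ var v) ∧ᶠ (α ∨ᶠ φ)))))

  -- Γ ⊢_Inc φ for a set Γ (a predicate on formulas): φ is derivable from
  -- finitely many assumptions, all in Γ.
  Derivable : (Fm → Set) → Fm → Set
  Derivable Γ φ = Σ (List Fm) (λ Δ → All Γ Δ × Δ ⊢ φ)

  _,,_ : (Fm → Set) → Fm → (Fm → Set)
  (Γ ,, ψ) χ = Γ χ ⊎ χ ≡ ψ

  ∼ : ∀ {n} → Vec Var n → Vec Var n → Fm → Fm
  ∼ x y αy = ∃* y ((y ⊆ᶠ x) ∧ᶠ ¬ᶠ αy)

-- Assume the hypotheses y ⊆ x and ¬α(y/x). By ∃-introduction along y they give ∼α, and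
-- cutting this against the given refutation of Γ, ∼α refutes Γ, y ⊆ x, ¬α(y/x). Since y is
-- fresh for Γ and the free variables of α(y/x) lie among y, the rule ⊆Exp (taken with z = x,
-- i.e. along the identity renaming) then yields α from Γ alone. The calculus has no cut rule;
-- cut is admissible through ∃I and ∃E on a variable fresh for the remaining assumptions.
module Submission where

open import Defs
open import Data.Product using (_×_; ∃; _,_; proj₁; proj₂; map₁; map₂)
open import Data.Vec using (Vec; []; _∷_; map; toList)
open import Data.Vec.Membership.Propositional using (_∈_)
open import Relation.Nullary using (¬_; yes; no)

open import Data.Bool using (true; false; if_then_else_)
open import Data.Empty using (⊥-elim)
open import Data.List using (List; []; _∷_; concatMap) renaming (_++_ to _++ₗ_)
open import Data.List.Extrema.Nat using (max; xs≤max)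
open import Data.List.Membership.Propositional using (lose) renaming (_∈_ to _∈ₗ_)
open import Data.List.Membership.Propositional.Properties using (∈-++⁻; ∈-++⁺ˡ; ∈-++⁺ʳ; ∈-concatMap⁺)
open import Data.List.Relation.Binary.Subset.Propositional using () renaming (_⊆_ to _⊆ₗ_)
open import Data.List.Relation.Unary.All as All using (All; []; _∷_)
open import Data.List.Relation.Unary.Any using (here; there)
open import Data.Nat using (ℕ; zero; suc; _≡ᵇ_; _≟_)
open import Data.Nat.Properties using (<-irrefl)
open import Data.Sum using (inj₁; inj₂)
open import Data.Vec.Membership.Propositional.Properties using (∈-toList⁺)
open import Data.Vec.Properties using (map-cong; ∷-injective)
import Data.Vec.Relation.Unary.Any as Anyᵥ
open import Function using (_∘_)
open import Relation.Binary.PropositionalEquality using (_≡_; _≢_; refl; sym; trans; cong; cong₂; subst)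

≡ᵇ-refl : ∀ n → (n ≡ᵇ n) ≡ true
≡ᵇ-refl zero = refl
≡ᵇ-refl (suc n) = ≡ᵇ-refl n

≢⇒≡ᵇ≡false : ∀ {m n} → m ≢ n → (m ≡ᵇ n) ≡ false
≢⇒≡ᵇ≡false {zero} {zero} m≢n = ⊥-elim (m≢n refl)
≢⇒≡ᵇ≡false {zero} {suc n} _ = refl
≢⇒≡ᵇ≡false {suc m} {zero} _ = refl
≢⇒≡ᵇ≡false {suc m} {suc n} m≢n = ≢⇒≡ᵇ≡false (m≢n ∘ cong suc)

if-≡ᵇ-self : ∀ n {A : Set} {a b : A} → (if n ≡ᵇ n then a else b) ≡ a
if-≡ᵇ-self n rewrite ≡ᵇ-refl n = refl

if-≡ᵇ-other : ∀ {m n} {A : Set} {a b : A} → m ≢ n → (if m ≡ᵇ n then a else b) ≡ b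
if-≡ᵇ-other m≢n rewrite ≢⇒≡ᵇ≡false m≢n = refl

freshℕ : List ℕ → ℕ
freshℕ ns = suc (max 0 ns)

freshℕ-∉ : ∀ ns → ¬ (freshℕ ns ∈ₗ ns)
freshℕ-∉ ns m = <-irrefl refl (All.lookup (xs≤max 0 ns) m)

module _ {ℒ : Signature} where
  open Syntax ℒ

  varsF : Fm → List Var
  varsF ⊥ᶠ = []
  varsF (t ≐ u) = varsT t ++ₗ varsT u
  varsF (rel R ts) = varsTs ts
  varsF (¬ᶠ φ) = varsF φ
  varsF (φ ∧ᶠ ψ) = varsF φ ++ₗ varsF ψ
  varsF (φ ∨ᶠ ψ) = varsF φ ++ₗ varsF ψ
  varsF (∃ᶠ x φ) = varsF φ
  varsF (∀ᶠ x φ) = varsF φ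
  varsF (xs ⊆ᶠ ys) = toList xs ++ₗ toList ys

  FreeIn⇒∈varsF : ∀ {v} φ → FreeIn v φ → v ∈ₗ varsF φ
  FreeIn⇒∈varsF (t ≐ u) (inj₁ p) = ∈-++⁺ˡ p
  FreeIn⇒∈varsF (t ≐ u) (inj₂ p) = ∈-++⁺ʳ (varsT t) p
  FreeIn⇒∈varsF (rel R ts) p = p
  FreeIn⇒∈varsF (¬ᶠ φ) p = FreeIn⇒∈varsF φ p
  FreeIn⇒∈varsF (φ ∧ᶠ ψ) (inj₁ p) = ∈-++⁺ˡ (FreeIn⇒∈varsF φ p)
  FreeIn⇒∈varsF (φ ∧ᶠ ψ) (inj₂ p) = ∈-++⁺ʳ (varsF φ) (FreeIn⇒∈varsF ψ p)
  FreeIn⇒∈varsF (φ ∨ᶠ ψ) (inj₁ p) = ∈-++⁺ˡ (FreeIn⇒∈varsF φ p)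
  FreeIn⇒∈varsF (φ ∨ᶠ ψ) (inj₂ p) = ∈-++⁺ʳ (varsF φ) (FreeIn⇒∈varsF ψ p)
  FreeIn⇒∈varsF (∃ᶠ x φ) (_ , p) = FreeIn⇒∈varsF φ p
  FreeIn⇒∈varsF (∀ᶠ x φ) (_ , p) = FreeIn⇒∈varsF φ p
  FreeIn⇒∈varsF (xs ⊆ᶠ ys) (inj₁ p) = ∈-++⁺ˡ (∈-toList⁺ p)
  FreeIn⇒∈varsF (xs ⊆ᶠ ys) (inj₂ p) = ∈-++⁺ʳ (toList xs) (∈-toList⁺ p)

  fresh : List Fm → Var
  fresh Δ = freshℕ (concatMap varsF Δ)

  fresh-notFree : ∀ Δ → All (λ χ → ¬ FreeIn (fresh Δ) χ) Δ
  fresh-notFree Δ = All.tabulate λ {χ} χ∈Δ free →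
    freshℕ-∉ _ (∈-concatMap⁺ varsF (lose χ∈Δ (FreeIn⇒∈varsF χ free)))

  IsIdentity : Subst → Set
  IsIdentity σ = ∀ z → σ z ≡ var z

  keep-self : ∀ σ y → keep σ y y ≡ var y
  keep-self σ y = if-≡ᵇ-self y

  keep-other : ∀ σ {y z} → z ≢ y → keep σ y z ≡ σ z
  keep-other σ = if-≡ᵇ-other

  keep-identity : ∀ {σ} → IsIdentity σ → ∀ y → IsIdentity (keep σ y)
  keep-identity {σ} id y z with z ≟ y
  ... | yes refl = keep-self σ y
  ... | no z≢y = trans (keep-other σ z≢y) (id z)

  -- [ x ↦ var x ] is definitionally keep var x, and [ x ∷ xs ↦* map var (x ∷ xs) ] is
  -- definitionally keep [ xs ↦* map var xs ] x.
  [↦var]-identity : ∀ x → IsIdentity [ x ↦ var x ]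
  [↦var]-identity = keep-identity λ _ → refl

  [↦*map-var]-identity : ∀ {n} (xs : Vec Var n) → IsIdentity [ xs ↦* map var xs ]
  [↦*map-var]-identity [] _ = refl
  [↦*map-var]-identity (x ∷ xs) = keep-identity ([↦*map-var]-identity xs) x

  mutual
    subT-identity : ∀ {σ} → IsIdentity σ → ∀ t → subT σ t ≡ t
    subT-identity id (var x) = id x
    subT-identity id (app f ts) = cong (app f) (subTs-identity id ts)

    subTs-identity : ∀ {σ} → IsIdentity σ → ∀ {n} (ts : Vec Term n) → subTs σ ts ≡ ts
    subTs-identity id [] = refl
    subTs-identity id (t ∷ ts) = cong₂ _∷_ (subT-identity id t) (subTs-identity id ts)

  identity-avoidsCapture : ∀ {σ} → IsIdentity σ → ∀ {y} x → x ≢ y → ¬ y ∈ₗ varsT (σ x)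
  identity-avoidsCapture id x x≢y y∈ with subst (λ t → _ ∈ₗ varsT t) (id x) y∈
  ... | here y≡x = x≢y (sym y≡x)

  Sub-identity : ∀ {σ} → IsIdentity σ → ∀ φ → Sub σ φ φ
  Sub-identity id ⊥ᶠ = s⊥
  Sub-identity {σ} id (t ≐ u) =
    subst (Sub σ (t ≐ u)) (cong₂ _≐_ (subT-identity id t) (subT-identity id u)) s≐
  Sub-identity {σ} id (rel R ts) =
    subst (Sub σ (rel R ts) ∘ rel R) (subTs-identity id ts) srel
  Sub-identity id (¬ᶠ φ) = s¬ (Sub-identity id φ)
  Sub-identity id (φ ∧ᶠ ψ) = s∧ (Sub-identity id φ) (Sub-identity id ψ)
  Sub-identity id (φ ∨ᶠ ψ) = s∨ (Sub-identity id φ) (Sub-identity id ψ)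
  Sub-identity id (∃ᶠ y φ) = s∃ (λ x → identity-avoidsCapture id x ∘ proj₁) (Sub-identity (keep-identity id y) φ)
  Sub-identity id (∀ᶠ y φ) = s∀ (λ x → identity-avoidsCapture id x ∘ proj₁) (Sub-identity (keep-identity id y) φ)
  Sub-identity id (xs ⊆ᶠ ys) = s⊆ (map-cong id xs) (map-cong id ys)

  ∈varsT-subst : ∀ {v s t} → s ≡ t → v ∈ₗ varsT s → v ∈ₗ varsT t
  ∈varsT-subst s≡t = subst (λ t → _ ∈ₗ varsT t) s≡t

  mutual
    varsT-subT : ∀ {σ v} t → v ∈ₗ varsT (subT σ t) → ∃ λ u → u ∈ₗ varsT t × v ∈ₗ varsT (σ u)
    varsT-subT (var x) v∈ = x , here refl , v∈
    varsT-subT (app f ts) v∈ = varsTs-subTs ts v∈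

    varsTs-subTs : ∀ {σ v n} (ts : Vec Term n) → v ∈ₗ varsTs (subTs σ ts) →
                   ∃ λ u → u ∈ₗ varsTs ts × v ∈ₗ varsT (σ u)
    varsTs-subTs {σ} (t ∷ ts) v∈ with ∈-++⁻ (varsT (subT σ t)) v∈
    ... | inj₁ p = map₂ (map₁ ∈-++⁺ˡ) (varsT-subT t p)
    ... | inj₂ p = map₂ (map₁ (∈-++⁺ʳ (varsT t))) (varsTs-subTs ts p)

  ∈-map-var : ∀ {σ v n} (xs xs′ : Vec Var n) → map σ xs ≡ map var xs′ → v ∈ xs′ →
              ∃ λ u → u ∈ xs × v ∈ₗ varsT (σ u)
  ∈-map-var (x ∷ xs) (x′ ∷ xs′) eq (Anyᵥ.here refl) =
    x , Anyᵥ.here refl , ∈varsT-subst (sym (proj₁ (∷-injective eq))) (here refl)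
  ∈-map-var (x ∷ xs) (x′ ∷ xs′) eq (Anyᵥ.there p) =
    map₂ (map₁ Anyᵥ.there) (∈-map-var xs xs′ (proj₂ (∷-injective eq)) p)

  ∈varsT-keep : ∀ σ {y u v} → v ∈ₗ varsT (keep σ y u) → v ≢ y → u ≢ y × v ∈ₗ varsT (σ u)
  ∈varsT-keep σ {y} {u} v∈ v≢y with u ≟ y
  ... | no u≢y = u≢y , ∈varsT-subst (keep-other σ u≢y) v∈
  ... | yes refl with ∈varsT-subst (keep-self σ y) v∈
  ...   | here v≡y = ⊥-elim (v≢y v≡y)

  FreeIn-Sub-binder : ∀ σ {y v} {P : Var → Set} → v ≢ y →
                      (∃ λ u → P u × v ∈ₗ varsT (keep σ y u)) →
                      ∃ λ u → (u ≢ y × P u) × v ∈ₗ varsT (σ u)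
  FreeIn-Sub-binder σ v≢y (u , Pu , v∈) =
    let u≢y , v∈σu = ∈varsT-keep σ v∈ v≢y in u , (u≢y , Pu) , v∈σu

  FreeIn-Sub : ∀ {σ φ φ′ v} → Sub σ φ φ′ → FreeIn v φ′ → ∃ λ u → FreeIn u φ × v ∈ₗ varsT (σ u)
  FreeIn-Sub (s≐ {t}) (inj₁ p) = map₂ (map₁ inj₁) (varsT-subT t p)
  FreeIn-Sub (s≐ {u = u}) (inj₂ p) = map₂ (map₁ inj₂) (varsT-subT u p)
  FreeIn-Sub (srel {ts = ts}) p = varsTs-subTs ts p
  FreeIn-Sub (s¬ s) p = FreeIn-Sub s p
  FreeIn-Sub (s∧ s _) (inj₁ p) = map₂ (map₁ inj₁) (FreeIn-Sub s p)
  FreeIn-Sub (s∧ _ s) (inj₂ p) = map₂ (map₁ inj₂) (FreeIn-Sub s p)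
  FreeIn-Sub (s∨ s _) (inj₁ p) = map₂ (map₁ inj₁) (FreeIn-Sub s p)
  FreeIn-Sub (s∨ _ s) (inj₂ p) = map₂ (map₁ inj₂) (FreeIn-Sub s p)
  FreeIn-Sub {σ} (s∃ _ s) (v≢y , p) = FreeIn-Sub-binder σ v≢y (FreeIn-Sub s p)
  FreeIn-Sub {σ} (s∀ _ s) (v≢y , p) = FreeIn-Sub-binder σ v≢y (FreeIn-Sub s p)
  FreeIn-Sub (s⊆ {xs = xs} {xs' = xs′} eq _) (inj₁ p) = map₂ (map₁ inj₁) (∈-map-var xs xs′ eq p)
  FreeIn-Sub (s⊆ {ys = ys} {ys' = ys′} _ eq) (inj₂ p) = map₂ (map₁ inj₂) (∈-map-var ys ys′ eq p)

  ∈varsT-[↦*map-var] : ∀ {n u v} (xs ys : Vec Var n) → u ∈ xs →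
                       v ∈ₗ varsT ([ xs ↦* map var ys ] u) → v ∈ ys
  ∈varsT-[↦*map-var] {u = u} (x ∷ xs) (y ∷ ys) u∈ v∈ with u ≟ x
  ... | yes refl with ∈varsT-subst (if-≡ᵇ-self u) v∈
  ...   | here refl = Anyᵥ.here refl
  ∈varsT-[↦*map-var] (x ∷ xs) (y ∷ ys) (Anyᵥ.here u≡x) v∈ | no u≢x = ⊥-elim (u≢x u≡x)
  ∈varsT-[↦*map-var] (x ∷ xs) (y ∷ ys) (Anyᵥ.there u∈) v∈ | no u≢x =
    Anyᵥ.there (∈varsT-[↦*map-var] xs ys u∈ (∈varsT-subst (if-≡ᵇ-other u≢x) v∈))

  FreeIn-renaming : ∀ {n α α′} {xs ys : Vec Var n} → (∀ v → FreeIn v α → v ∈ xs) →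
                    Sub [ xs ↦* map var ys ] α α′ → ∀ v → FreeIn v α′ → v ∈ ys
  FreeIn-renaming {xs = xs} {ys} fv sub v free =
    let u , u-free , v∈ = FreeIn-Sub sub free in ∈varsT-[↦*map-var] xs ys (fv u u-free) v∈

  FreeIn⇒Occurs : ∀ {v} φ → FreeIn v φ → Occurs v φ
  FreeIn⇒Occurs (t ≐ u) p = p
  FreeIn⇒Occurs (rel R ts) p = p
  FreeIn⇒Occurs (¬ᶠ φ) p = FreeIn⇒Occurs φ p
  FreeIn⇒Occurs (φ ∧ᶠ ψ) (inj₁ p) = inj₁ (FreeIn⇒Occurs φ p)
  FreeIn⇒Occurs (φ ∧ᶠ ψ) (inj₂ p) = inj₂ (FreeIn⇒Occurs ψ p)
  FreeIn⇒Occurs (φ ∨ᶠ ψ) (inj₁ p) = inj₁ (FreeIn⇒Occurs φ p)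
  FreeIn⇒Occurs (φ ∨ᶠ ψ) (inj₂ p) = inj₂ (FreeIn⇒Occurs ψ p)
  FreeIn⇒Occurs (∃ᶠ x φ) (_ , p) = inj₂ (FreeIn⇒Occurs φ p)
  FreeIn⇒Occurs (∀ᶠ x φ) (_ , p) = inj₂ (FreeIn⇒Occurs φ p)
  FreeIn⇒Occurs (xs ⊆ᶠ ys) p = p

  ∃*-intro : ∀ {Δ ψ n} (ys : Vec Var n) → Δ ⊢ ψ → Δ ⊢ ∃* ys ψ
  ∃*-intro [] d = d
  ∃*-intro {ψ = ψ} (y ∷ ys) d = ∃I (Sub-identity ([↦var]-identity y) (∃* ys ψ)) (∃*-intro ys d)

  cut : ∀ {Δ Δ′ χ ψ} → Δ ⊢ χ → (χ ∷ Δ′) ⊢ ψ → (Δ ++ₗ Δ′) ⊢ ψ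
  cut {Δ′ = Δ′} {χ} {ψ} dχ dψ with fresh-notFree (ψ ∷ Δ′)
  ... | ψ-notFree ∷ Δ′-notFree =
    ∃E ψ-notFree Δ′-notFree (∃I (Sub-identity ([↦var]-identity (fresh (ψ ∷ Δ′))) χ) dχ) dψ

  split-,, : ∀ {Γ ψ Δ} → All (Γ ,, ψ) Δ → ∃ λ Δ′ → All Γ Δ′ × Δ ⊆ₗ ψ ∷ Δ′
  split-,, [] = [] , [] , λ ()
  split-,, {ψ = ψ} (inj₁ γ ∷ Δ∈) =
    let Δ′ , Γ-Δ′ , Δ⊆ = split-,, Δ∈ in
    _ ∷ Δ′ , γ ∷ Γ-Δ′ , λ { (here refl) → there (here refl) ; (there χ∈) → insert (Δ⊆ χ∈) }
    where
      insert : ∀ {χ φ Δ′} → χ ∈ₗ ψ ∷ Δ′ → χ ∈ₗ ψ ∷ φ ∷ Δ′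
      insert (here χ≡ψ) = here χ≡ψ
      insert (there χ∈) = there (there χ∈)
  split-,, (inj₂ refl ∷ Δ∈) =
    let Δ′ , Γ-Δ′ , Δ⊆ = split-,, Δ∈ in
    Δ′ , Γ-Δ′ , λ { (here refl) → here refl ; (there χ∈) → Δ⊆ χ∈ }

  ∼RAA : ∀ {Δ n α αy} {x y : Vec Var n} → FO α → (∀ v → FreeIn v α → v ∈ x) →
         Distinct x → Distinct y → Sub [ x ↦* map var y ] α αy →
         All (λ χ → ∀ v → v ∈ y → ¬ FreeIn v χ) Δ →
         (∼ x y αy ∷ Δ) ⊢ ⊥ᶠ → Δ ⊢ α
  ∼RAA {α = α} {x = x} {y} FO-α fv-α x-distinct y-distinct sub y-notFree refutation =
    ⊆Exp {z = x} FO-α x-distinct y-distinct sub (Sub-identity ([↦*map-var]-identity x) α)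
         (FreeIn-renaming fv-α sub) y-notFree
         (cut (∃*-intro y (∧I (hyp (here refl)) (hyp (there (here refl))))) refutation)

mainTheorem6 : (ℒ : Signature) → let open Syntax ℒ in
    (Γ : Fm → Set) → (∀ φ → Γ φ → IsInc φ) →
    ∀ {n} (x y : Vec Var n) (α αy : Fm) →
    FO α → (∀ v → FreeIn v α → v ∈ x) →
    Distinct x → Distinct y →
    (∀ v → v ∈ y → (¬ (v ∈ x)) × (¬ Occurs v α) × (∀ φ → Γ φ → ¬ Occurs v φ)) →
    Sub [ x ↦* map var y ] α αy →
    Derivable (Γ ,, ∼ x y αy) ⊥ᶠ →
    Derivable Γ α
mainTheorem6 ℒ Γ _ x y α αy FO-α fv-α x-distinct y-distinct y-fresh sub (Δ , Δ∈ , refutation) =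
  let Δ′ , Γ-Δ′ , Δ⊆ = split-,, Δ∈ in
  Δ′ , Γ-Δ′ , ∼RAA FO-α fv-α x-distinct y-distinct sub (All.map y-notFree Γ-Δ′) (weak Δ⊆ refutation)
  where
    open Syntax ℒ

    y-notFree : ∀ {χ} → Γ χ → ∀ v → v ∈ y → ¬ FreeIn v χ
    y-notFree {χ} γ v v∈y = proj₂ (proj₂ (y-fresh v v∈y)) χ γ ∘ FreeIn⇒Occurs χ
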